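{- Let $n\ge2$ and ${\tt k}=\{k_1<\dots<k_{d-1}\}\subseteq\{1,\dots,n-1\}$. Then $\mathbb{Y}_{{\tt k}}\subseteq\Theta_{{\tt k}}$: the inversion set of every $w\in S_n^{{\tt k}}$ is a ${\tt k}$-diagram.
   Context: $S_n^{{\tt k}}$ is the set of $w\in S_n$ with descents ($w(i)>w(i+1)$) only at positions $i\in{\tt k}$. $\Omega_{GL_n}$ is the poset of pairs $(a,b)$, $1\le a<b\le n$, with $(a',b')\preceq(a,b)$ iff $a\le a'$ and $b'\le b$. The inversion set (RYD) of $w$ is $\{(a,b):a<b, w(a)>w(b)\}$, and $\mathbb{Y}_{{\tt k}}$ is the set of inversion sets of elements of $S_n^{{\tt k}}$. Set $k_0=0,k_d=n$, $I_i=[k_{i-1}+1,k_i]$, $\Lambda^{ij}_{{\tt k}}=\{(a,b):a\in I_i,b\in I_j\}$ ($1\le i<j\le d$). The hook of $(a,b)$ is $\{(a,l):a<l<b\}\cup\{(j,b):a<j<b\}$. $S\subseteq\Omega_{GL_n}$ is a ${\tt k}$-diagram if each $S\cap\Lambda^{ij}_{{\tt k}}$ is a lower order ideal of $\Lambda^{ij}_{{\tt k}}$ and, for every $(a,b)$, $(a,b)\in S$ whenever more than half of its hook lies in $S$, and $(a,b)\notin S$ whenever more than half of its hook lies outside $S$. $\Theta_{{\tt k}}$ is the set of ${\tt k}$-diagrams. -}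

module Defs where

open import Data.Nat using (ℕ; zero; suc; _+_; _*_; _∸_; _≤_; _<_; _<?_; _<ᵇ_)
open import Data.Bool using (Bool; true; false; T; if_then_else_)
open import Data.Fin using (Fin; toℕ; fromℕ<)
open import Data.Fin.Permutation using (Permutation′; _⟨$⟩ʳ_)
open import Data.List using (List; length; filterᵇ; applyUpTo)
open import Data.List.Membership.Propositional using (_∈_)
open import Data.List.Relation.Unary.All using (All)
open import Data.List.Relation.Unary.AllPairs using (AllPairs)
open import Data.Product using (_×_)
open import Relation.Nullary using (¬_; yes; no)
open import Relation.Binary.PropositionalEquality using (_≡_)

-- Positions and values are 1-based natural numbers, as in the paper.
-- A permutation w ∈ S_n is a bijection Fin n ↔ Fin n (library notion);
-- wval w a is the 1-based value w(a) for 1 ≤ a ≤ n (and 0 outside this range).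
wval : {n : ℕ} → Permutation′ n → ℕ → ℕ
wval {n} w zero = zero
wval {n} w (suc a) with a <? n
... | yes p = suc (toℕ (w ⟨$⟩ʳ fromℕ< p))
... | no _ = zero

ValidK : ℕ → List ℕ → Set
ValidK n k = AllPairs _<_ k × All (λ x → 1 ≤ x × x < n) k

InSk : (n : ℕ) → List ℕ → Permutation′ n → Set
InSk n k w = ∀ i → 1 ≤ i → i < n → wval w (suc i) < wval w i → i ∈ k

InΩ : ℕ → ℕ → ℕ → Set
InΩ n a b = 1 ≤ a × a < b × b ≤ n

-- Subsets of Ω_{GL_n} are represented by decidable (Bool-valued) predicates on pairs;
-- only their values on pairs in Ω matter.
-- Inversion set (RYD) of w.
inv : {n : ℕ} → Permutation′ n → ℕ → ℕ → Bool
inv w a b = if a <ᵇ b then wval w b <ᵇ wval w a else false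

-- Block index: a ∈ I_{blk k a + 1}, where blk k a = #{x ∈ k : x < a}.
blk : List ℕ → ℕ → ℕ
blk k a = length (filterᵇ (λ x → x <ᵇ a) k)

countBetween : (ℕ → Bool) → ℕ → ℕ → ℕ
countBetween f a b = length (filterᵇ f (applyUpTo (λ i → suc (a + i)) (b ∸ suc a)))

-- |hook(a,b) ∩ S| : hook = {(a,l) : a<l<b} ∪ {(j,b) : a<j<b}
hookIn : (ℕ → ℕ → Bool) → ℕ → ℕ → ℕ
hookIn S a b = countBetween (λ l → S a l) a b + countBetween (λ j → S j b) a b

hookSize : ℕ → ℕ → ℕ
hookSize a b = 2 * (b ∸ suc a)

IsKDiagram : ℕ → List ℕ → (ℕ → ℕ → Bool) → Set
IsKDiagram n k S =
  -- each S ∩ Λ^{ij}_k (i < j) is a lower order ideal of Λ^{ij}_k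
  (∀ a b a' b' → InΩ n a b → InΩ n a' b' →
     blk k a < blk k b → blk k a' ≡ blk k a → blk k b' ≡ blk k b →
     a ≤ a' → b' ≤ b → T (S a b) → T (S a' b'))
  ×
  (∀ a b → InΩ n a b → hookSize a b < 2 * hookIn S a b → T (S a b))
  ×
  (∀ a b → InΩ n a b → hookSize a b < 2 * (hookSize a b ∸ hookIn S a b) → ¬ T (S a b))

module Submission where

-- Write f(a) for the value w(a).  For a < b the pair (a,b) is an inversion
-- iff f(b) < f(a), and the hook of (a,b) is indexed by the positions l with
-- a < l < b, each contributing the two cells (a,l) and (l,b).
--  * Hook conditions (valid for ANY sequence f : ℕ → ℕ): if f(a) ≤ f(b), no l
--    makes both (a,l) and (l,b) inversions, so at most half of the hook lies
--    in the inversion set; if f(b) < f(a), every l makes one of them an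
--    inversion, so at least half of the hook lies in it.  Either way the
--    strict-majority conditions are satisfied.
--  * Lower ideal: a descent of w at position i lies in k, and every element of
--    k in [a, a') separates the blocks of a and a'.  Hence f is weakly
--    increasing inside each block I_i, and from a ≤ a' < b' ≤ b with a,a' and
--    b,b' in the same blocks we get f(b') ≤ f(b) < f(a) ≤ f(a').
-- The file first proves counting facts about filters of lists, then the
-- hook estimates for arbitrary sequences, then monotonicity within blocks,
-- and finally assembles the three clauses of IsKDiagram.

open import Defs
open import Data.Nat using (ℕ; suc; _+_; _*_; _∸_; _≤_; _<_; _≤′_; ≤′-refl; ≤′-step; _<ᵇ_; _<?_; z≤n; s≤s)
open import Data.Nat.Properties
open import Data.Bool using (Bool; true; false; T; if_then_else_)
open import Data.Empty using (⊥-elim)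
open import Data.Sum using (_⊎_; inj₁; inj₂)
open import Data.Product using (_×_; _,_)
open import Data.List using (List; []; _∷_; length; filterᵇ; applyUpTo)
open import Data.List.Properties using (length-applyUpTo)
open import Data.List.Membership.Propositional using (_∈_)
open import Data.List.Relation.Unary.All using (All; []; _∷_)
open import Data.List.Relation.Unary.Any using (here; there)
open import Data.List.Relation.Unary.All.Properties using (applyUpTo⁺₁)
open import Data.Fin.Permutation using (Permutation′)
open import Relation.Nullary using (¬_; yes; no)
open import Relation.Binary.PropositionalEquality using (_≡_; refl; sym; trans; subst)

count : {A : Set} → (A → Bool) → List A → ℕ
count p xs = length (filterᵇ p xs)

count-disjoint : {A : Set} (p q : A → Bool) (xs : List A) →
  All (λ x → T (p x) → ¬ T (q x)) xs → count p xs + count q xs ≤ length xs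
count-disjoint p q [] [] = z≤n
count-disjoint p q (x ∷ xs) (px⇒¬qx ∷ rest) with p x | q x | count-disjoint p q xs rest
... | true  | true  | _ = ⊥-elim (px⇒¬qx _ _)
... | true  | false | ih = s≤s ih
... | false | true  | ih = subst (_≤ suc (length xs)) (sym (+-suc _ _)) (s≤s ih)
... | false | false | ih = m≤n⇒m≤1+n ih

count-covering : {A : Set} (p q : A → Bool) (xs : List A) →
  All (λ x → T (p x) ⊎ T (q x)) xs → length xs ≤ count p xs + count q xs
count-covering p q [] [] = z≤n
count-covering p q (x ∷ xs) (px⊎qx ∷ rest) with p x | q x | count-covering p q xs rest
... | true  | true  | ih = s≤s (≤-trans ih (+-monoʳ-≤ _ (n≤1+n _)))
... | true  | false | ih = s≤s ih
... | false | true  | ih = subst (suc (length xs) ≤_) (sym (+-suc _ _)) (s≤s ih)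
... | false | false | _ with px⊎qx
...   | inj₁ ()
...   | inj₂ ()

count-mono : {A : Set} (p q : A → Bool) → (∀ x → T (p x) → T (q x)) →
  (xs : List A) → count p xs ≤ count q xs
count-mono p q p⇒q [] = z≤n
count-mono p q p⇒q (x ∷ xs) with p x | q x | p⇒q x | count-mono p q p⇒q xs
... | true  | true  | _    | ih = s≤s ih
... | true  | false | px⇒qx | _ = ⊥-elim (px⇒qx _)
... | false | true  | _    | ih = m≤n⇒m≤1+n ih
... | false | false | _    | ih = ih

count-strict : {A : Set} (p q : A → Bool) → (∀ x → T (p x) → T (q x)) →
  {y : A} → ¬ T (p y) → T (q y) → (xs : List A) → y ∈ xs → count p xs < count q xs
count-strict p q p⇒q {y} ¬py qy (y ∷ xs) (here refl) with p y | q y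
... | true  | _     = ⊥-elim (¬py _)
... | false | true  = s≤s (count-mono p q p⇒q xs)
... | false | false = ⊥-elim qy
count-strict p q p⇒q ¬py qy (x ∷ xs) (there y∈xs)
  with p x | q x | p⇒q x | count-strict p q p⇒q ¬py qy xs y∈xs
... | true  | true  | _    | ih = s≤s ih
... | true  | false | px⇒qx | _ = ⊥-elim (px⇒qx _)
... | false | true  | _    | ih = m≤n⇒m≤1+n ih
... | false | false | _    | ih = ih

-- Inversion set of an arbitrary sequence f; inv w is inversions (wval w).
inversions : (ℕ → ℕ) → ℕ → ℕ → Bool
inversions f a b = if a <ᵇ b then f b <ᵇ f a else false

module Inversions (f : ℕ → ℕ) where

  inversion-intro : ∀ {a b} → a < b → f b < f a → T (inversions f a b)
  inversion-intro {a} {b} a<b fb<fa with a <ᵇ b | <⇒<ᵇ a<b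
  ... | true | _ = <⇒<ᵇ fb<fa

  inversion-elim : ∀ {a b} → a < b → T (inversions f a b) → f b < f a
  inversion-elim {a} {b} a<b inv-ab with a <ᵇ b | <⇒<ᵇ a<b
  ... | true | _ = <ᵇ⇒< (f b) (f a) inv-ab

  hookPosition-between : ∀ a b {i} → a < b → i < b ∸ suc a → a < suc (a + i) × suc (a + i) < b
  hookPosition-between a b {i} a<b i<m =
    s≤s (m≤m+n a i) , subst (suc (a + i) <_) (m+[n∸m]≡n a<b) (+-monoʳ-< (suc a) i<m)

  forAllHookPositions : ∀ a b → a < b → {P : ℕ → Set} → (∀ l → a < l → l < b → P l) →
    All P (applyUpTo (λ i → suc (a + i)) (b ∸ suc a))
  forAllHookPositions a b a<b P-between =
    applyUpTo⁺₁ _ (b ∸ suc a) λ i<m →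
      let (a<l , l<b) = hookPosition-between a b a<b i<m in P-between _ a<l l<b

  hook-upper : ∀ a b → a < b → f a ≤ f b → hookIn (inversions f) a b ≤ b ∸ suc a
  hook-upper a b a<b fa≤fb =
    subst (hookIn (inversions f) a b ≤_) (length-applyUpTo _ (b ∸ suc a))
      (count-disjoint _ _ _ (forAllHookPositions a b a<b notBoth))
    where
    notBoth : ∀ l → a < l → l < b → T (inversions f a l) → ¬ T (inversions f l b)
    notBoth l a<l l<b inv-al inv-lb =
      <-irrefl refl (<-trans (≤-<-trans fa≤fb (inversion-elim l<b inv-lb)) (inversion-elim a<l inv-al))

  hook-lower : ∀ a b → a < b → f b < f a → b ∸ suc a ≤ hookIn (inversions f) a b
  hook-lower a b a<b fb<fa =
    subst (_≤ hookIn (inversions f) a b) (length-applyUpTo _ (b ∸ suc a))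
      (count-covering _ _ _ (forAllHookPositions a b a<b oneOf))
    where
    oneOf : ∀ l → a < l → l < b → T (inversions f a l) ⊎ T (inversions f l b)
    oneOf l a<l l<b with f l <? f a
    ... | yes fl<fa = inj₁ (inversion-intro a<l fl<fa)
    ... | no  fl≮fa = inj₂ (inversion-intro l<b (<-≤-trans fb<fa (≮⇒≥ fl≮fa)))

  hook-majority : ∀ a b → a < b →
    hookSize a b < 2 * hookIn (inversions f) a b → T (inversions f a b)
  hook-majority a b a<b majority with f b <? f a
  ... | yes fb<fa = inversion-intro a<b fb<fa
  ... | no  fb≮fa =
    ⊥-elim (<-irrefl refl (<-≤-trans majority (*-monoʳ-≤ 2 (hook-upper a b a<b (≮⇒≥ fb≮fa)))))

  hook-minority : ∀ a b → a < b →
    hookSize a b < 2 * (hookSize a b ∸ hookIn (inversions f) a b) → ¬ T (inversions f a b)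
  hook-minority a b a<b minority inv-ab =
    <-irrefl refl (<-≤-trans minority (*-monoʳ-≤ 2 outside≤m))
    where
    m = b ∸ suc a
    outside≤m : 2 * m ∸ hookIn (inversions f) a b ≤ m
    outside≤m = subst (2 * m ∸ hookIn (inversions f) a b ≤_) (trans (m+n∸m≡n m (m + 0)) (+-identityʳ m))
                  (∸-monoʳ-≤ (2 * m) (hook-lower a b a<b (inversion-elim a<b inv-ab)))

  ascending : ∀ {a a'} → a ≤′ a' → (∀ i → a ≤ i → i < a' → f i ≤ f (suc i)) → f a ≤ f a'
  ascending ≤′-refl      _      = ≤-refl
  ascending (≤′-step a≤′a') noDesc =
    ≤-trans (ascending a≤′a' (λ i a≤i i<a' → noDesc i a≤i (m<n⇒m<1+n i<a')))
            (noDesc _ (≤′⇒≤ a≤′a') ≤-refl)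

block-separated : (k : List ℕ) {a a' i : ℕ} → a ≤ i → i < a' → i ∈ k → blk k a < blk k a'
block-separated k {a} {a'} {i} a≤i i<a' i∈k =
  count-strict (_<ᵇ a) (_<ᵇ a') below-a⇒below-a' (λ i<ᵇa → <⇒≱ (<ᵇ⇒< i a i<ᵇa) a≤i) (<⇒<ᵇ i<a') k i∈k
  where
  below-a⇒below-a' : ∀ x → T (x <ᵇ a) → T (x <ᵇ a')
  below-a⇒below-a' x x<ᵇa = <⇒<ᵇ (<-≤-trans (<ᵇ⇒< x a x<ᵇa) (≤-trans a≤i (<⇒≤ i<a')))

module BlockAscending (n : ℕ) (k : List ℕ) (w : Permutation′ n) (descents-in-k : InSk n k w) where
  open Inversions (wval w)

  -- w(a) ≤ w(a') for a ≤ a' in the same block: a descent between them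
  -- would be an element of k separating their blocks.
  ascending-in-block : ∀ {a a'} → 1 ≤ a → a ≤ a' → a' ≤ n → blk k a ≡ blk k a' →
    wval w a ≤ wval w a'
  ascending-in-block {a} {a'} 1≤a a≤a' a'≤n same-block =
    ascending (≤⇒≤′ a≤a') λ i a≤i i<a' → ≮⇒≥ λ descent →
      <-irrefl same-block
        (block-separated k a≤i i<a' (descents-in-k i (≤-trans 1≤a a≤i) (<-≤-trans i<a' a'≤n) descent))

  lower-ideal : ∀ a b a' b' → InΩ n a b → InΩ n a' b' →
    blk k a' ≡ blk k a → blk k b' ≡ blk k b → a ≤ a' → b' ≤ b →
    T (inv w a b) → T (inv w a' b')
  lower-ideal a b a' b' (1≤a , a<b , b≤n) (1≤a' , a'<b' , b'≤n) same-a same-b a≤a' b'≤b inv-ab =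
    inversion-intro a'<b'
      (begin-strict
        wval w b'  ≤⟨ ascending-in-block (≤-trans 1≤a' (<⇒≤ a'<b')) b'≤b b≤n same-b ⟩
        wval w b   <⟨ inversion-elim a<b inv-ab ⟩
        wval w a   ≤⟨ ascending-in-block 1≤a a≤a' (<⇒≤ (<-≤-trans a'<b' b'≤n)) (sym same-a) ⟩
        wval w a'  ∎)
    where open ≤-Reasoning

claim2p4 : (n : ℕ) → 2 ≤ n → (k : List ℕ) → ValidK n k →
    (w : Permutation′ n) → InSk n k w → IsKDiagram n k (inv w)
claim2p4 n _ k _ w descents-in-k =
    (λ a b a' b' Ωab Ωa'b' _ → lower-ideal a b a' b' Ωab Ωa'b')
  , (λ a b (_ , a<b , _) → hook-majority a b a<b)
  , (λ a b (_ , a<b , _) → hook-minority a b a<b)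
  where
  open Inversions (wval w)
  open BlockAscending n k w descents-in-k
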